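{- Let $m,m'\geq 2$ and $n,n'\geq 0$ with $(m,n)\neq(m',n')$. Then $X_{L_{m,n}}\neq X_{L_{m',n'}}$.
   Context: All graphs are finite and simple. For a graph $G$ with vertex set $\{v_1,\dots,v_N\}$, the chromatic symmetric function is $X_G=\sum_\kappa x_{\kappa(v_1)}\cdots x_{\kappa(v_N)}$, summed over all proper colourings $\kappa:V\to\{1,2,\dots\}$. $K_m$ is the complete graph on $m$ vertices, $P_n$ the path on $n$ vertices. For $m,n\geq1$ the lollipop graph $L_{m,n}$ is obtained from the disjoint union of $K_m$ and $P_n$ by adding an edge joining a vertex of $K_m$ to an end vertex of $P_n$; by convention $L_{m,0}=K_m$. -}

module Defs where

open import Data.Nat using (ℕ; zero; suc; _+_; _<ᵇ_; _≡ᵇ_)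
open import Data.Nat.Base using (_⊔_)
open import Data.Bool using (Bool; true; false; _∧_; _∨_; not; if_then_else_)
open import Data.Fin using (Fin; toℕ; _≟_)
open import Data.List using (List; []; _∷_; map; concatMap; allFin; length; lookup)
open import Data.Bool.ListAction using (and)
open import Relation.Nullary.Decidable using (⌊_⌋)

-- A finite simple graph on the vertex set Fin N, given by a Boolean
-- adjacency relation (intended symmetric and irreflexive).
record Graph : Set where
  field
    N   : ℕ
    adj : Fin N → Fin N → Bool
open Graph public

-- Lollipop graph L_{m,n} on vertices 0,…,m+n-1:
-- vertices 0..m-1 form K_m; vertices m-1, m, m+1, …, m+n-1 form a path
-- (so m-1 ∈ K_m is joined to the end vertex m of P_n = m..m+n-1).
-- i ~ j  iff  (i ≠ j, i < m, j < m)  or  (|i-j| = 1 and max i j ≥ m).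
lollipopAdj : (m n : ℕ) → Fin (m + n) → Fin (m + n) → Bool
lollipopAdj m n i j =
  let a = toℕ i ; b = toℕ j in
  (not (a ≡ᵇ b) ∧ (a <ᵇ m) ∧ (b <ᵇ m))
  ∨ (((suc a ≡ᵇ b) ∨ (suc b ≡ᵇ a)) ∧ not ((a ⊔ b) <ᵇ m))

Lollipop : ℕ → ℕ → Graph
Lollipop m n = record { N = m + n ; adj = lollipopAdj m n }

consF : ∀ {k N} → Fin k → (Fin N → Fin k) → Fin (suc N) → Fin k
consF c f Fin.zero    = c
consF c f (Fin.suc i) = f i

allColourings : (k N : ℕ) → List (Fin N → Fin k)
allColourings k zero    = (λ ()) ∷ []
allColourings k (suc N) =
  concatMap (λ c → map (consF c) (allColourings k N)) (allFin k)

countB : ∀ {A : Set} → (A → Bool) → List A → ℕ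
countB p []       = 0
countB p (x ∷ xs) = if p x then suc (countB p xs) else countB p xs

_==F_ : ∀ {k} → Fin k → Fin k → Bool
i ==F j = ⌊ i ≟ j ⌋

isProper : (G : Graph) {k : ℕ} → (Fin (N G) → Fin k) → Bool
isProper G κ =
  and (concatMap (λ u → map (λ v → not (adj G u v ∧ (κ u ==F κ v))) (allFin (N G)))
                 (allFin (N G)))

hasType : (G : Graph) (a : List ℕ) → (Fin (N G) → Fin (length a)) → Bool
hasType G a κ =
  and (map (λ c → countB (λ v → κ v ==F c) (allFin (N G)) ≡ᵇ lookup a c)
           (allFin (length a)))

-- The chromatic symmetric function X_G, represented by its coefficients:
-- X G a = coefficient of the monomial x₁^{a₁} ⋯ x_k^{a_k} (k = length a) in X_G,
-- i.e. the number of proper colourings κ : V → {1,2,…} with |κ⁻¹(i)| = a_i for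
-- i ≤ k (and hence using no colour > k).
X : Graph → List ℕ → ℕ
X G a = countB (λ κ → isProper G κ ∧ hasType G a κ) (allColourings (length a) (N G))

module Submission where

-- Lollipops L_{m,n} with m ≥ 2 have pairwise different chromatic symmetric
-- functions: for two different lollipops we exhibit a monomial x^a whose
-- coefficient is positive in one X and zero in the other.
--
-- Then for lollipops: L_{m,n} is m-colourable and contains K_m, so for m < m′
-- the type of an m-colouring of L_{m,n} separates it from L_{m′,n′}; for m = m′
-- and n < n′ the identity colouring of L_{m,n} separates it from the larger
-- L_{m,n′}.

open import Defs
open import Data.Nat using (ℕ; zero; suc; _+_; _≤_; _<_; z≤n; s≤s)
open import Data.Nat.Properties
  using (≤-refl; ≤-trans; ≤-reflexive; ≤-pred; n≤1+n; 1+n≢n; suc-injective; <-cmp; +-monoʳ-<;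
         ≡ᵇ⇒≡; ≡⇒≡ᵇ; <ᵇ⇒<; <⇒<ᵇ; ≮⇒≥; <⇒≱; m≤n⇒m⊔n≡n; m≥n⇒m⊔n≡m)
open import Data.Bool using (Bool; true; false; _∧_; not; T)
open import Data.Bool.Properties using (T-∧; T-∨)
open import Data.Bool.ListAction using (and)
open import Data.Fin using (Fin; toℕ; _≟_; fromℕ<; _↑ˡ_; cast)
open import Data.Fin.Properties using (toℕ-fromℕ<; toℕ-↑ˡ; toℕ<n; toℕ-injective; pigeonhole; cast-involutive)
  renaming (<⇒≢ to <⇒≢ᶠ; suc-injective to sucᶠ-injective)
open import Data.List using (List; []; _∷_; map; allFin; length; lookup; tabulate)
open import Data.List.Properties using (map-tabulate; length-tabulate; lookup-tabulate)
open import Data.List.Relation.Unary.All as All using (All; []; _∷_)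
open import Data.List.Relation.Unary.All.Properties using (all⁺; all⁻; map⁺; map⁻; concat⁺; concat⁻)
open import Data.List.Relation.Unary.Any using (here; there)
open import Data.List.Membership.Propositional using (_∈_; lose)
open import Data.List.Membership.Propositional.Properties using (∈-allFin; ∈-map⁺; ∈-concatMap⁺)
open import Data.Product using (_×_; _,_; Σ; ∃-syntax)
open import Data.Sum using (_⊎_; inj₁; inj₂)
open import Data.Empty using (⊥; ⊥-elim)
open import Data.Unit using (tt)
open import Function using (_∘_; Equivalence)
open import Relation.Binary.PropositionalEquality
open import Relation.Binary.Definitions using (tri<; tri≈; tri>)
open import Relation.Nullary using (¬_; yes; no)
open import Relation.Nullary.Decidable using (toWitness; fromWitness)

open Equivalence using (to; from)

T-not : ∀ {b} → ¬ T b → T (not b)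
T-not {true}  ¬t = ¬t tt
T-not {false} _  = tt

T-not⁻ : ∀ {b} → T (not b) → ¬ T b
T-not⁻ {true} ()

and⁺ : {bs : List Bool} → All T bs → T (and bs)
and⁺ []       = tt
and⁺ (t ∷ ts) = from T-∧ (t , and⁺ ts)

and⁻ : {bs : List Bool} → T (and bs) → All T bs
and⁻ {[]}     _ = []
and⁻ {b ∷ bs} t with to (T-∧ {b}) t
... | tb , tbs = tb ∷ and⁻ tbs

==F-cong : ∀ {k l} {i j : Fin k} {i′ j′ : Fin l} →
           (i ≡ j → i′ ≡ j′) → (i′ ≡ j′ → i ≡ j) → (i ==F j) ≡ (i′ ==F j′)
==F-cong {i = i} {j} {i′} {j′} fwd bwd with i ≟ j | i′ ≟ j′
... | yes _   | yes _    = refl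
... | no  _   | no  _    = refl
... | yes i≡j | no  i′≢j′ = ⊥-elim (i′≢j′ (fwd i≡j))
... | no  i≢j | yes i′≡j′ = ⊥-elim (i≢j (bwd i′≡j′))

module _ {A : Set} where

  countB-hit : {p : A → Bool} {x : A} (xs : List A) → T (p x) →
               countB p (x ∷ xs) ≡ suc (countB p xs)
  countB-hit {p} {x} xs px with p x | px
  ... | true | _ = refl

  countB-cons : (p : A → Bool) (x : A) (xs : List A) → countB p xs ≤ countB p (x ∷ xs)
  countB-cons p x xs with p x
  ... | true  = n≤1+n _
  ... | false = ≤-refl

  countB-pos : {p : A → Bool} {x : A} {xs : List A} → x ∈ xs → T (p x) → 1 ≤ countB p xs
  countB-pos {xs = x ∷ xs} (here refl) px = subst (1 ≤_) (sym (countB-hit xs px)) (s≤s z≤n)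
  countB-pos {p} {xs = y ∷ xs} (there x∈xs) px = ≤-trans (countB-pos x∈xs px) (countB-cons p y xs)

  countB-two : {p : A → Bool} {x y : A} {xs : List A} → x ∈ xs → y ∈ xs → x ≢ y →
               T (p x) → T (p y) → 2 ≤ countB p xs
  countB-two (here refl) (here refl) x≢y _ _ = ⊥-elim (x≢y refl)
  countB-two {xs = x ∷ xs} (here refl) (there y∈xs) _ px py =
    ≤-trans (s≤s (countB-pos y∈xs py)) (≤-reflexive (sym (countB-hit xs px)))
  countB-two {xs = y ∷ xs} (there x∈xs) (here refl) _ px py =
    ≤-trans (s≤s (countB-pos x∈xs px)) (≤-reflexive (sym (countB-hit xs py)))
  countB-two {p} {xs = z ∷ xs} (there x∈xs) (there y∈xs) x≢y px py =
    ≤-trans (countB-two x∈xs y∈xs x≢y px py) (countB-cons p z xs)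

  countB-zero : {p : A → Bool} → (∀ x → ¬ T (p x)) → (xs : List A) → countB p xs ≡ 0
  countB-zero         never []       = refl
  countB-zero {p} never (x ∷ xs) with p x | never x
  ... | true  | ¬px = ⊥-elim (¬px tt)
  ... | false | _   = countB-zero never xs

  countB-cong : {p q : A → Bool} → (∀ x → p x ≡ q x) → (xs : List A) → countB p xs ≡ countB q xs
  countB-cong         p≗q []       = refl
  countB-cong {p} {q} p≗q (x ∷ xs) rewrite p≗q x with q x
  ... | true  = cong suc (countB-cong p≗q xs)
  ... | false = countB-cong p≗q xs

countB-map : {A B : Set} (p : B → Bool) (f : A → B) (xs : List A) →
             countB p (map f xs) ≡ countB (p ∘ f) xs
countB-map p f []       = refl
countB-map p f (x ∷ xs) with p (f x)
... | true  = cong suc (countB-map p f xs)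
... | false = countB-map p f xs

Proper : (G : Graph) {k : ℕ} → (Fin (N G) → Fin k) → Set
Proper G κ = ∀ u v → T (adj G u v) → κ u ≢ κ v

classSize : (G : Graph) {k : ℕ} → (Fin (N G) → Fin k) → Fin k → ℕ
classSize G κ c = countB (λ v → κ v ==F c) (allFin (N G))

HasType : (G : Graph) (a : List ℕ) → (Fin (N G) → Fin (length a)) → Set
HasType G a κ = ∀ c → classSize G κ c ≡ lookup a c

isProper-sound : (G : Graph) {k : ℕ} (κ : Fin (N G) → Fin k) → Proper G κ → T (isProper G κ)
isProper-sound G κ proper =
  and⁺ (concat⁺ (map⁺ (All.universal (λ u → map⁺ (All.universal (entry u) V)) V)))
  where
  V = allFin (N G)
  entry : ∀ u v → T (not (adj G u v ∧ (κ u ==F κ v)))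
  entry u v = T-not λ t → let (uv , same) = to T-∧ t in proper u v uv (toWitness same)

isProper-complete : (G : Graph) {k : ℕ} (κ : Fin (N G) → Fin k) → T (isProper G κ) → Proper G κ
isProper-complete G κ t u v uv same = T-not⁻ entry (from T-∧ (uv , fromWitness same))
  where
  rows = map⁻ (concat⁻ (and⁻ t))
  entry : T (not (adj G u v ∧ (κ u ==F κ v)))
  entry = All.lookup (map⁻ (All.lookup rows (∈-allFin u))) (∈-allFin v)

hasType-sound : (G : Graph) (a : List ℕ) (κ : Fin (N G) → Fin (length a)) →
                HasType G a κ → T (hasType G a κ)
hasType-sound G a κ type = all⁻ _ (All.universal (λ c → ≡⇒≡ᵇ _ _ (type c)) (allFin (length a)))

hasType-complete : (G : Graph) (a : List ℕ) (κ : Fin (N G) → Fin (length a)) →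
                   T (hasType G a κ) → HasType G a κ
hasType-complete G a κ t c = ≡ᵇ⇒≡ _ _ (All.lookup (all⁺ _ _ t) (∈-allFin c))


allColourings-complete : ∀ k N (κ : Fin N → Fin k) →
                         ∃[ κ′ ] κ′ ∈ allColourings k N × (∀ v → κ′ v ≡ κ v)
allColourings-complete k zero    κ = (λ ()) , here refl , λ ()
allColourings-complete k (suc N) κ with allColourings-complete k N (κ ∘ Fin.suc)
... | κ′ , κ′∈ , κ′≗ =
  consF (κ Fin.zero) κ′ ,
  ∈-concatMap⁺ (λ c → map (consF c) (allColourings k N))
               (lose (∈-allFin (κ Fin.zero)) (∈-map⁺ (consF (κ Fin.zero)) κ′∈)) ,
  λ { Fin.zero → refl ; (Fin.suc v) → κ′≗ v }

X-positive : (G : Graph) (a : List ℕ) (κ : Fin (N G) → Fin (length a)) →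
             Proper G κ → HasType G a κ → 1 ≤ X G a
X-positive G a κ proper type with allColourings-complete (length a) (N G) κ
... | κ′ , κ′∈ , κ′≗κ =
  countB-pos κ′∈ (from T-∧ (isProper-sound G κ′ proper′ , hasType-sound G a κ′ type′))
  where
  proper′ : Proper G κ′
  proper′ u v uv same = proper u v uv (trans (sym (κ′≗κ u)) (trans same (κ′≗κ v)))
  type′ : HasType G a κ′
  type′ c = trans (countB-cong (λ v → cong (_==F c) (κ′≗κ v)) (allFin (N G))) (type c)

X-vanishes : (G : Graph) (a : List ℕ) →
             (∀ κ → Proper G κ → HasType G a κ → ⊥) → X G a ≡ 0
X-vanishes G a none = countB-zero never (allColourings (length a) (N G))
  where
  never : ∀ κ → ¬ T (isProper G κ ∧ hasType G a κ)
  never κ t with to T-∧ t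
  ... | p , h = none κ (isProper-complete G κ p) (hasType-complete G a κ h)

typeOf : (G : Graph) {k : ℕ} → (Fin (N G) → Fin k) → List ℕ
typeOf G κ = tabulate (classSize G κ)

length-typeOf : (G : Graph) {k : ℕ} (κ : Fin (N G) → Fin k) → length (typeOf G κ) ≡ k
length-typeOf G κ = length-tabulate (classSize G κ)

lookup-typeOf : (G : Graph) {k : ℕ} (κ : Fin (N G) → Fin k) (c : Fin (length (typeOf G κ))) →
                lookup (typeOf G κ) c ≡ classSize G κ (cast (length-typeOf G κ) c)
lookup-typeOf G κ c = begin
  lookup (typeOf G κ) c
    ≡⟨ cong (lookup (typeOf G κ)) (sym (cast-involutive (sym L) L c)) ⟩
  lookup (typeOf G κ) (cast (sym L) (cast L c))
    ≡⟨ lookup-tabulate (classSize G κ) (cast L c) ⟩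
  classSize G κ (cast L c) ∎
  where
  open ≡-Reasoning
  L = length-typeOf G κ

typeOf-positive : (G : Graph) {k : ℕ} (κ : Fin (N G) → Fin k) → Proper G κ →
                  1 ≤ X G (typeOf G κ)
typeOf-positive G κ proper = X-positive G (typeOf G κ) κ′ proper′ type′
  where
  L = length-typeOf G κ
  κ′ : Fin (N G) → Fin (length (typeOf G κ))
  κ′ = cast (sym L) ∘ κ
  uncast : ∀ {x y} → cast (sym L) x ≡ y → x ≡ cast L y
  uncast {x} e = trans (sym (cast-involutive L (sym L) x)) (cong (cast L) e)
  recast : ∀ {x y} → x ≡ cast L y → cast (sym L) x ≡ y
  recast {y = y} e = trans (cong (cast (sym L)) e) (cast-involutive (sym L) L y)
  proper′ : Proper G κ′
  proper′ u v uv same = proper u v uv (trans (uncast same) (cast-involutive L (sym L) (κ v)))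
  type′ : HasType G (typeOf G κ) κ′
  type′ c = trans (countB-cong (λ v → ==F-cong uncast recast) (allFin (N G)))
                  (sym (lookup-typeOf G κ c))

IsClique : (G : Graph) {l : ℕ} → (Fin l → Fin (N G)) → Set
IsClique G ι = ∀ i j → i ≢ j → T (adj G (ι i) (ι j))

clique-vanishes : (G : Graph) (a : List ℕ) {l : ℕ} (ι : Fin l → Fin (N G)) →
                  IsClique G ι → length a < l → X G a ≡ 0
clique-vanishes G a ι clique a<l = X-vanishes G a λ κ proper _ →
  let (i , j , i<j , same) = pigeonhole a<l (κ ∘ ι)
  in proper (ι i) (ι j) (clique i j (<⇒≢ᶠ i<j)) same

-- A squarefree monomial in fewer variables than G has vertices has
-- coefficient zero: some colour class would have two elements.
squarefree-vanishes : (G : Graph) (a : List ℕ) → length a < N G →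
                      (∀ c → lookup a c ≤ 1) → X G a ≡ 0
squarefree-vanishes G a a<N squarefree = X-vanishes G a λ κ _ type →
  let (i , j , i<j , same) = pigeonhole a<N κ
      two : 2 ≤ classSize G κ (κ i)
      two = countB-two (∈-allFin i) (∈-allFin j) (<⇒≢ᶠ i<j) (fromWitness refl) (fromWitness (sym same))
  in <⇒≱ (≤-trans two (≤-reflexive (type (κ i)))) (squarefree (κ i))


Separates : Graph → Graph → Set
Separates G H = Σ (List ℕ) λ a → 1 ≤ X G a × X H a ≡ 0

separated : {G H : Graph} → Separates G H ⊎ Separates H G → ¬ (∀ a → X G a ≡ X H a)
separated (inj₁ (a , pos , vanish)) same with subst (1 ≤_) (trans (same a) vanish) pos
... | ()
separated (inj₂ (a , pos , vanish)) same with subst (1 ≤_) (trans (sym (same a)) vanish) pos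
... | ()

clique-separates : (G H : Graph) {k l : ℕ} (κ : Fin (N G) → Fin k) → Proper G κ →
                   (ι : Fin l → Fin (N H)) → IsClique H ι → k < l → Separates G H
clique-separates G H κ proper ι clique k<l =
  typeOf G κ , typeOf-positive G κ proper ,
  clique-vanishes H (typeOf G κ) ι clique (subst (_< _) (sym (length-typeOf G κ)) k<l)

-- An irreflexive graph G is separated from any graph with more vertices by the
-- type of its identity colouring, whose colour classes are all singletons.
fewer-vertices-separates : (G H : Graph) → (∀ v → ¬ T (adj G v v)) → N G < N H → Separates G H
fewer-vertices-separates G H irrefl N<N =
  typeOf G identity , typeOf-positive G identity proper ,
  squarefree-vanishes H (typeOf G identity)
    (subst (_< N H) (sym L) N<N)
    (λ c → ≤-reflexive (trans (lookup-typeOf G identity c) (singleton-class (cast L c))))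
  where
  identity : Fin (N G) → Fin (N G)
  identity v = v
  L = length-typeOf G identity
  proper : Proper G identity
  proper u v uv refl = irrefl u uv
  singleton-class : ∀ {n} (c : Fin n) → countB (_==F c) (allFin n) ≡ 1
  singleton-class {suc n} c
    rewrite sym (map-tabulate {n = n} (λ v → v) Fin.suc)
          | countB-map (_==F c) Fin.suc (allFin n) with c
  ... | Fin.zero  = cong suc (countB-zero (λ v ()) (allFin n))
  ... | Fin.suc d = trans (countB-cong (λ v → ==F-cong sucᶠ-injective (cong Fin.suc)) (allFin n))
                          (singleton-class d)


data LollipopEdge (m a b : ℕ) : Set where
  clique-edge : a ≢ b → a < m → b < m → LollipopEdge m a b
  path-up     : suc a ≡ b → m ≤ b → LollipopEdge m a b
  path-down   : suc b ≡ a → m ≤ a → LollipopEdge m a b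

lollipop-edge : ∀ m n (u v : Fin (m + n)) → T (lollipopAdj m n u v) → LollipopEdge m (toℕ u) (toℕ v)
lollipop-edge m n u v uv with to T-∨ uv
... | inj₁ inK with to T-∧ inK
...   | u≢v , inside with to T-∧ inside
...     | u<m , v<m = clique-edge (T-not⁻ u≢v ∘ ≡⇒≡ᵇ _ _) (<ᵇ⇒< _ m u<m) (<ᵇ⇒< _ m v<m)
lollipop-edge m n u v uv | inj₂ onPath with to T-∧ onPath
... | step , outside with to T-∨ step | ≮⇒≥ (T-not⁻ outside ∘ <⇒<ᵇ)
...   | inj₁ up   | m≤u⊔v =
  path-up e (subst (m ≤_) (m≤n⇒m⊔n≡n (subst (toℕ u ≤_) e (n≤1+n _))) m≤u⊔v)
  where e = ≡ᵇ⇒≡ _ _ up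
...   | inj₂ down | m≤u⊔v =
  path-down e (subst (m ≤_) (m≥n⇒m⊔n≡m (subst (toℕ v ≤_) e (n≤1+n _))) m≤u⊔v)
  where e = ≡ᵇ⇒≡ _ _ down

lollipop-irreflexive : ∀ m n (v : Fin (m + n)) → ¬ T (lollipopAdj m n v v)
lollipop-irreflexive m n v vv with lollipop-edge m n v v vv
... | clique-edge v≢v _ _ = v≢v refl
... | path-up   e _       = 1+n≢n e
... | path-down e _       = 1+n≢n e

lollipop-clique : ∀ m n → IsClique (Lollipop m n) (_↑ˡ n)
lollipop-clique m n i j i≢j =
  from T-∨ (inj₁ (from T-∧ (T-not (i≢j ∘ toℕ-injective′ ∘ ≡ᵇ⇒≡ _ _) ,
                            from T-∧ (<⇒<ᵇ (below i) , <⇒<ᵇ (below j)))))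
  where
  below : ∀ i → toℕ (i ↑ˡ n) < m
  below i = subst (_< m) (sym (toℕ-↑ˡ i n)) (toℕ<n i)
  toℕ-injective′ : toℕ (i ↑ˡ n) ≡ toℕ (j ↑ˡ n) → i ≡ j
  toℕ-injective′ e = toℕ-injective (trans (sym (toℕ-↑ˡ i n)) (trans e (toℕ-↑ˡ j n)))

-- A colouring of the vertices 0,1,2,… of L_{2+m₀,n}: vertex v < 2 + m₀ gets
-- colour v, and the path continues alternating between colours m₀ and 1+m₀.
parity : ℕ → ℕ
parity zero          = 0
parity (suc zero)    = 1
parity (suc (suc v)) = parity v

lollipopColour : ℕ → ℕ → ℕ
lollipopColour zero     v       = parity v
lollipopColour (suc m₀) zero    = 0
lollipopColour (suc m₀) (suc v) = suc (lollipopColour m₀ v)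

lollipopColour-bound : ∀ m₀ v → lollipopColour m₀ v < 2 + m₀
lollipopColour-bound zero     zero          = s≤s z≤n
lollipopColour-bound zero     (suc zero)    = s≤s (s≤s z≤n)
lollipopColour-bound zero     (suc (suc v)) = lollipopColour-bound zero v
lollipopColour-bound (suc m₀) zero          = s≤s z≤n
lollipopColour-bound (suc m₀) (suc v)       = s≤s (lollipopColour-bound m₀ v)

lollipopColour-clique : ∀ m₀ v → v < 2 + m₀ → lollipopColour m₀ v ≡ v
lollipopColour-clique zero     zero          _       = refl
lollipopColour-clique zero     (suc zero)    _       = refl
lollipopColour-clique zero     (suc (suc v)) (s≤s (s≤s ()))
lollipopColour-clique (suc m₀) zero          _       = refl
lollipopColour-clique (suc m₀) (suc v)       (s≤s v<) = cong suc (lollipopColour-clique m₀ v v<)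

lollipopColour-path : ∀ m₀ a → suc m₀ ≤ a → lollipopColour m₀ a ≢ lollipopColour m₀ (suc a)
lollipopColour-path zero     a             _       = parity-step a
  where
  parity-step : ∀ a → parity a ≢ parity (suc a)
  parity-step zero          ()
  parity-step (suc zero)    ()
  parity-step (suc (suc a)) = parity-step a
lollipopColour-path (suc m₀) (suc a)       (s≤s a≥) = lollipopColour-path m₀ a a≥ ∘ suc-injective

lollipop-colourable : ∀ m n → 2 ≤ m → Σ (Fin (m + n) → Fin m) (Proper (Lollipop m n))
lollipop-colourable (suc (suc m₀)) n (s≤s (s≤s z≤n)) = κ , proper
  where
  colour = lollipopColour m₀
  κ : Fin (2 + m₀ + n) → Fin (2 + m₀)
  κ v = fromℕ< (lollipopColour-bound m₀ (toℕ v))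
  same-colour : ∀ u v → κ u ≡ κ v → colour (toℕ u) ≡ colour (toℕ v)
  same-colour u v e = trans (sym (toℕ-fromℕ< (lollipopColour-bound m₀ (toℕ u))))
                        (trans (cong toℕ e) (toℕ-fromℕ< (lollipopColour-bound m₀ (toℕ v))))
  distinct : ∀ {a b} → LollipopEdge (2 + m₀) a b → colour a ≢ colour b
  distinct {a} {b} (clique-edge a≢b a< b<) e =
    a≢b (trans (sym (lollipopColour-clique m₀ a a<)) (trans e (lollipopColour-clique m₀ b b<)))
  distinct {a} (path-up refl m≤b) e = lollipopColour-path m₀ a (≤-pred m≤b) e
  distinct {b = b} (path-down refl m≤a) e = lollipopColour-path m₀ b (≤-pred m≤a) (sym e)
  proper : Proper (Lollipop (2 + m₀) n) κ
  proper u v uv e = distinct (lollipop-edge (2 + m₀) n u v uv) (same-colour u v e)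

smaller-clique-separates : ∀ m n m′ n′ → 2 ≤ m → m < m′ → Separates (Lollipop m n) (Lollipop m′ n′)
smaller-clique-separates m n m′ n′ 2≤m m<m′ with lollipop-colourable m n 2≤m
... | κ , proper =
  clique-separates (Lollipop m n) (Lollipop m′ n′) κ proper (_↑ˡ n′) (lollipop-clique m′ n′) m<m′

lollipops-separated : ∀ m n m′ n′ → 2 ≤ m → 2 ≤ m′ → ¬ (m ≡ m′ × n ≡ n′) →
  Separates (Lollipop m n) (Lollipop m′ n′) ⊎ Separates (Lollipop m′ n′) (Lollipop m n)
lollipops-separated m n m′ n′ 2≤m 2≤m′ different with <-cmp m m′
... | tri< m<m′ _ _ = inj₁ (smaller-clique-separates m n m′ n′ 2≤m m<m′)
... | tri> _ _ m′<m = inj₂ (smaller-clique-separates m′ n′ m n 2≤m′ m′<m)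
... | tri≈ _ refl _ with <-cmp n n′
...   | tri< n<n′ _ _ = inj₁ (fewer-vertices-separates (Lollipop m n) (Lollipop m n′)
                                (lollipop-irreflexive m n) (+-monoʳ-< m n<n′))
...   | tri> _ _ n′<n = inj₂ (fewer-vertices-separates (Lollipop m n′) (Lollipop m n)
                                (lollipop-irreflexive m n′) (+-monoʳ-< m n′<n))
...   | tri≈ _ refl _ = ⊥-elim (different (refl , refl))


lemma3p7 : (m n m′ n′ : ℕ) → 2 ≤ m → 2 ≤ m′ → ¬ (m ≡ m′ × n ≡ n′)
    → ¬ ((a : List ℕ) → X (Lollipop m n) a ≡ X (Lollipop m′ n′) a)
lemma3p7 m n m′ n′ 2≤m 2≤m′ different =
  separated {Lollipop m n} {Lollipop m′ n′} (lollipops-separated m n m′ n′ 2≤m 2≤m′ different)
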